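{- Let $n$ be a positive even integer. Then for every subtournament $H$ of $L_n$, $\det(H)\le\det(L_n)=(n-1)^2$, with equality if and only if $H$ is $L_n$.
   Context: A tournament is a directed graph with exactly one arc between each pair of distinct vertices; $u\rightarrow v$ means the arc goes from $u$ to $v$. A subtournament is the tournament induced by a nonempty vertex subset. For a tournament $T$ on vertices $w_1,\dots,w_n$, its skew-adjacency matrix is the zero-diagonal matrix $S_T=[s_{ij}]$ with $s_{ij}=-s_{ji}=1$ if $w_i\rightarrow w_j$, and $\det(T):=\det(S_T)$. For $m\ge 2$, $L_m$ is the tournament on vertices $u_1,\dots,u_m$ with $u_i\rightarrow u_j$ for $1\le i<j\le m-1$, and for $1\le i\le m-1$: $u_m\rightarrow u_i$ if $i$ is odd and $u_i\rightarrow u_m$ if $i$ is even. "$H$ is $L_n$" means $H$ is isomorphic to $L_n$. -}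

module Defs where

open import Data.Nat as ℕ using (ℕ; zero; suc; _∸_; _<ᵇ_; _≡ᵇ_; _%_)
open import Data.Integer as ℤ using (ℤ; +_; -_)
open import Data.Fin using (Fin; zero; suc; toℕ; punchIn; _≟_)
open import Data.Bool using (Bool; true; false; if_then_else_; _∧_; not)
open import Data.Product using (Σ)
open import Relation.Nullary using (does)
open import Relation.Binary.PropositionalEquality using (_≡_)
open import Function.Bundles using (_↔_; Inverse)

-- A (labelled) tournament on vertex set Fin n is given by its arc relation:
-- arc i j ≡ true  means  i → j.
Arcs : ℕ → Set
Arcs n = Fin n → Fin n → Bool

-- The tournament L_m on vertices u_1..u_m; vertex u_(i+1) is (i : Fin m).
--  u_i → u_j for 1 ≤ i < j ≤ m-1;
--  for 1 ≤ i ≤ m-1: u_m → u_i if i odd, u_i → u_m if i even.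
-- In 0-based indices a = i-1: u_m → a iff a even, a → u_m iff a odd.
L : (m : ℕ) → Arcs m
L m a b with toℕ a <ᵇ (m ∸ 1) | toℕ b <ᵇ (m ∸ 1)
... | true  | true  = toℕ a <ᵇ toℕ b
... | true  | false = toℕ a % 2 ≡ᵇ 1
... | false | true  = toℕ b % 2 ≡ᵇ 0
... | false | false = false

induced : {n k : ℕ} → Arcs n → (Fin k → Fin n) → Arcs k
induced T f i j = T (f i) (f j)

skew : {n : ℕ} → Arcs n → Fin n → Fin n → ℤ
skew T i j = if does (i ≟ j) then + 0 else (if T i j then + 1 else - (+ 1))

sumFin : {n : ℕ} → (Fin n → ℤ) → ℤ
sumFin {zero}  f = + 0
sumFin {suc n} f = f zero ℤ.+ sumFin (λ i → f (suc i))

sgn : ℕ → ℤ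
sgn zero    = + 1
sgn (suc j) = - sgn j

det : {n : ℕ} → (Fin n → Fin n → ℤ) → ℤ
det {zero}  M = + 1
det {suc n} M =
  sumFin (λ j → sgn (toℕ j) ℤ.* (M zero j ℤ.* det (λ r c → M (suc r) (punchIn j c))))

Isomorphic : {k m : ℕ} → Arcs k → Arcs m → Set
Isomorphic {k} {m} T U =
  Σ (Fin k ↔ Fin m) (λ σ → ∀ i j → U (Inverse.to σ i) (Inverse.to σ j) ≡ T i j)

module Submission where

-- Relabelling a tournament by adjacent transpositions does not change its determinant, so the vertices of a
-- subtournament H of Lₙ may be listed increasingly with the largest one moved to the front. All other vertices
-- then lie in the transitive part of Lₙ, and the skew matrix of H is that of a transitive tournament on k
-- vertices bordered by a column c of ±1's. Two elementary operations on rows and two on columns split off the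
-- first two transitive vertices, which gives det = (k mod 2)(c₀ − c₁ + c₂ − ⋯)² ≤ k², with equality only for
-- k = n − 1. For Lₙ itself (n even, so k = n − 1 is odd) the alternating sum is −(n − 1).

open import Defs

module Determinant where

  open import Data.Nat.Base using (ℕ; zero; suc)
  open import Data.Fin.Base using (Fin; zero; suc; toℕ; punchIn; punchOut; inject₁)
  open import Data.Fin.Properties using (_≟_; punchInᵢ≢i; punchIn-injective; punchIn-punchOut; suc-injective)
  open import Data.Integer.Base using (ℤ; +_; -_; _+_; _*_; _-_)
  open import Data.Integer.Properties using (neg-involutive; *-zeroʳ; +-identityʳ; +-identityˡ)
  open import Data.Integer.Tactic.RingSolver using (solve-∀)
  open import Data.Bool.Base using (if_then_else_)
  open import Data.Product.Base using (Σ; _×_; _,_)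
  open import Data.Sum.Base using (_⊎_; inj₁; inj₂)
  open import Function.Base using (_∘_)
  open import Relation.Nullary using (Dec; does; yes; no)
  open import Relation.Nullary.Decidable using (dec-true; dec-false)
  open import Relation.Binary.PropositionalEquality

  Matrix : ℕ → Set
  Matrix n = Fin n → Fin n → ℤ

  sumFin-cong : ∀ {n} {f g : Fin n → ℤ} → (∀ i → f i ≡ g i) → sumFin f ≡ sumFin g
  sumFin-cong {zero}  e = refl
  sumFin-cong {suc n} e = cong₂ _+_ (e zero) (sumFin-cong (e ∘ suc))

  sumFin-+ : ∀ {n} (f g : Fin n → ℤ) → sumFin (λ i → f i + g i) ≡ sumFin f + sumFin g
  sumFin-+ {zero}  f g = refl
  sumFin-+ {suc n} f g =
    trans (cong (_+_ (f zero + g zero)) (sumFin-+ (f ∘ suc) (g ∘ suc)))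
          (interchange (f zero) (g zero) (sumFin (f ∘ suc)) (sumFin (g ∘ suc)))
    where
    interchange : ∀ a b c d → (a + b) + (c + d) ≡ (a + c) + (b + d)
    interchange = solve-∀

  sumFin-* : ∀ {n} t (f : Fin n → ℤ) → sumFin (λ i → t * f i) ≡ t * sumFin f
  sumFin-* {zero}  t f = sym (*-zeroʳ t)
  sumFin-* {suc n} t f =
    trans (cong (_+_ (t * f zero)) (sumFin-* t (f ∘ suc))) (distrib t (f zero) (sumFin (f ∘ suc)))
    where
    distrib : ∀ a b c → a * b + a * c ≡ a * (b + c)
    distrib = solve-∀

  sumFin-neg : ∀ {n} (f : Fin n → ℤ) → sumFin (λ i → - f i) ≡ - sumFin f
  sumFin-neg {zero}  f = refl
  sumFin-neg {suc n} f =
    trans (cong (_+_ (- f zero)) (sumFin-neg (f ∘ suc))) (distrib (f zero) (sumFin (f ∘ suc)))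
    where
    distrib : ∀ a b → - a + - b ≡ - (a + b)
    distrib = solve-∀

  sumFin-zero : ∀ {n} {f : Fin n → ℤ} → (∀ i → f i ≡ + 0) → sumFin f ≡ + 0
  sumFin-zero {zero}  e = refl
  sumFin-zero {suc n} e = cong₂ _+_ (e zero) (sumFin-zero (e ∘ suc))

  sumFin-single : ∀ {n} (f : Fin n → ℤ) k → (∀ j → j ≢ k → f j ≡ + 0) → sumFin f ≡ f k
  sumFin-single {suc n} f zero    e =
    trans (cong (_+_ (f zero)) (sumFin-zero λ j → e (suc j) λ ())) (+-identityʳ (f zero))
  sumFin-single {suc n} f (suc k) e =
    trans (cong (_+ sumFin (f ∘ suc)) (e zero λ ()))
          (trans (+-identityˡ (sumFin (f ∘ suc)))
                 (sumFin-single (f ∘ suc) k λ j j≢k → e (suc j) (j≢k ∘ suc-injective)))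

  minor : ∀ {n} → Matrix (suc n) → Fin (suc n) → Matrix n
  minor M j r c = M (suc r) (punchIn j c)

  laplaceTerm : ∀ {n} → Matrix (suc n) → Fin (suc n) → ℤ
  laplaceTerm M j = sgn (toℕ j) * (M zero j * det (minor M j))

  det-cong : ∀ {n} {M N : Matrix n} → (∀ i j → M i j ≡ N i j) → det M ≡ det N
  det-cong {zero}  e = refl
  det-cong {suc n} e = sumFin-cong λ j →
    cong₂ (λ a d → sgn (toℕ j) * (a * d)) (e zero j) (det-cong λ r c → e (suc r) (punchIn j c))

  det-linear-termwise : ∀ {n} (M N K : Matrix (suc n)) t →
    (∀ j → laplaceTerm M j ≡ laplaceTerm N j + t * laplaceTerm K j) → det M ≡ det N + t * det K
  det-linear-termwise M N K t e = begin
    sumFin (laplaceTerm M)                                ≡⟨ sumFin-cong e ⟩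
    sumFin (λ j → laplaceTerm N j + t * laplaceTerm K j)  ≡⟨ sumFin-+ (laplaceTerm N) (λ j → t * laplaceTerm K j) ⟩
    det N + sumFin (λ j → t * laplaceTerm K j)            ≡⟨ cong (_+_ (det N)) (sumFin-* t (laplaceTerm K)) ⟩
    det N + t * det K                                     ∎
    where open ≡-Reasoning

  det≡laplaceTerm : ∀ {n} (M : Matrix (suc n)) k → (∀ j → j ≢ k → M zero j ≡ + 0) → det M ≡ laplaceTerm M k
  det≡laplaceTerm M k e = sumFin-single (laplaceTerm M) k λ j j≢k →
    trans (cong (λ a → sgn (toℕ j) * (a * det (minor M j))) (e j j≢k)) (*-zeroʳ (sgn (toℕ j)))

  det-zeroCol : ∀ {n} (M : Matrix (suc n)) → (∀ i → M i zero ≡ + 0) → det M ≡ + 0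
  det-zeroCol {zero}  M e = cong (λ a → + 1 * (a * + 1) + + 0) (e zero)
  det-zeroCol {suc n} M e = sumFin-zero term
    where
    vanish : ∀ s a → s * (a * + 0) ≡ + 0
    vanish = solve-∀
    term : ∀ j → laplaceTerm M j ≡ + 0
    term zero    = cong (λ a → + 1 * (a * det (minor M zero))) (e zero)
    term (suc j) = trans (cong (λ d → sgn (toℕ (suc j)) * (M zero (suc j) * d))
                               (det-zeroCol (minor M (suc j)) (e ∘ suc)))
                         (vanish (sgn (toℕ (suc j))) (M zero (suc j)))

  det-2×2 : (M : Matrix 2) →
    det M ≡ M zero zero * M (suc zero) (suc zero) - M zero (suc zero) * M (suc zero) zero
  det-2×2 M = expand (M zero zero) (M zero (suc zero)) (M (suc zero) zero) (M (suc zero) (suc zero))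
    where
    expand : ∀ a b c d → + 1 * (a * (+ 1 * (d * + 1) + + 0)) + (- + 1 * (b * (+ 1 * (c * + 1) + + 0)) + + 0)
                         ≡ a * d - b * c
    expand = solve-∀

  setRow : ∀ {n} → Matrix n → Fin n → (Fin n → ℤ) → Matrix n
  setRow M b u i j = if does (i ≟ b) then u j else M i j

  setCol : ∀ {n} → Matrix n → Fin n → (Fin n → ℤ) → Matrix n
  setCol M b u i j = if does (j ≟ b) then u i else M i j

  setRow-at : ∀ {n} (M : Matrix n) b u j → setRow M b u b j ≡ u j
  setRow-at M b u j = cong (λ x → if x then u j else M b j) (dec-true (b ≟ b) refl)

  setRow-off : ∀ {n} (M : Matrix n) {a b} → a ≢ b → ∀ u j → setRow M b u a j ≡ M a j
  setRow-off M {a} {b} a≢b u j = cong (λ x → if x then u j else M a j) (dec-false (a ≟ b) a≢b)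

  setRow-self : ∀ {n} (M : Matrix n) b i j → setRow M b (M b) i j ≡ M i j
  setRow-self M b i j with i ≟ b
  ... | yes refl = refl
  ... | no _     = refl

  setCol-at : ∀ {n} (M : Matrix n) b u i → setCol M b u i b ≡ u i
  setCol-at M b u i = cong (λ x → if x then u i else M i b) (dec-true (b ≟ b) refl)

  setCol-off : ∀ {n} (M : Matrix n) {a b} → a ≢ b → ∀ u i → setCol M b u i a ≡ M i a
  setCol-off M {a} {b} a≢b u i = cong (λ x → if x then u i else M i a) (dec-false (a ≟ b) a≢b)

  setCol-self : ∀ {n} (M : Matrix n) b i j → setCol M b (λ i → M i b) i j ≡ M i j
  setCol-self M b i j with j ≟ b
  ... | yes refl = refl
  ... | no _     = refl

  private
    distribˡ : ∀ t s a b d → s * ((a + t * b) * d) ≡ s * (a * d) + t * (s * (b * d))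
    distribˡ = solve-∀

    distribʳ : ∀ t s a x y → s * (a * (x + t * y)) ≡ s * (a * x) + t * (s * (a * y))
    distribʳ = solve-∀

  -- Taking minors commutes with setRow definitionally: does (suc r ≟ suc b) reduces to does (r ≟ b).
  det-setRow-linear : ∀ {n} (M : Matrix n) b (u v : Fin n → ℤ) t →
    det (setRow M b (λ j → u j + t * v j)) ≡ det (setRow M b u) + t * det (setRow M b v)
  det-setRow-linear {suc n} M zero u v t =
    det-linear-termwise (setRow M zero (λ j → u j + t * v j)) (setRow M zero u) (setRow M zero v) t λ j →
      distribˡ t (sgn (toℕ j)) (u j) (v j) (det (minor M j))
  det-setRow-linear {suc n} M (suc b) u v t =
    det-linear-termwise (setRow M (suc b) (λ j → u j + t * v j)) (setRow M (suc b) u) (setRow M (suc b) v) t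
      λ j →
      trans (cong (λ d → sgn (toℕ j) * (M zero j * d))
                  (det-setRow-linear (minor M j) b (u ∘ punchIn j) (v ∘ punchIn j) t))
            (distribʳ t (sgn (toℕ j)) (M zero j) _ _)

  does-punchIn-≟ : ∀ {n} (j : Fin (suc n)) (c d : Fin n) → does (punchIn j c ≟ punchIn j d) ≡ does (c ≟ d)
  does-punchIn-≟ j c d with c ≟ d
  ... | yes refl = dec-true (punchIn j c ≟ punchIn j c) refl
  ... | no c≢d   = dec-false (punchIn j c ≟ punchIn j d) (c≢d ∘ punchIn-injective j c d)

  minor-setCol-at : ∀ {n} (M : Matrix (suc n)) b u r c → minor (setCol M b u) b r c ≡ minor M b r c
  minor-setCol-at M b u r c = cong (λ x → if x then u (suc r) else M (suc r) (punchIn b c))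
    (dec-false (punchIn b c ≟ b) (punchInᵢ≢i b c))

  minor-setCol-off : ∀ {n} (M : Matrix (suc n)) {j b} (j≢b : j ≢ b) u r c →
    minor (setCol M b u) j r c ≡ setCol (minor M j) (punchOut j≢b) (u ∘ suc) r c
  minor-setCol-off M {j} {b} j≢b u r c = cong (λ x → if x then u (suc r) else M (suc r) (punchIn j c))
    (trans (cong (λ b′ → does (punchIn j c ≟ b′)) (sym (punchIn-punchOut j≢b)))
           (does-punchIn-≟ j c (punchOut j≢b)))

  det-setCol-linear : ∀ {n} (M : Matrix n) b (u v : Fin n → ℤ) t →
    det (setCol M b (λ i → u i + t * v i)) ≡ det (setCol M b u) + t * det (setCol M b v)
  det-setCol-linear {suc n} M b u v t =
    det-linear-termwise (setCol M b w) (setCol M b u) (setCol M b v) t λ j → term j (j ≟ b)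
    where
    w = λ i → u i + t * v i
    term : ∀ j → Dec (j ≡ b) → laplaceTerm (setCol M b w) j
                              ≡ laplaceTerm (setCol M b u) j + t * laplaceTerm (setCol M b v) j
    term j (yes refl) = begin
      laplaceTerm (setCol M j w) j
        ≡⟨ entry w ⟩
      sgn (toℕ j) * (w zero * det (minor M j))
        ≡⟨ distribˡ t (sgn (toℕ j)) (u zero) (v zero) (det (minor M j)) ⟩
      sgn (toℕ j) * (u zero * det (minor M j)) + t * (sgn (toℕ j) * (v zero * det (minor M j)))
        ≡⟨ cong₂ (λ x y → x + t * y) (entry u) (entry v) ⟨
      laplaceTerm (setCol M j u) j + t * laplaceTerm (setCol M j v) j ∎
      where
      open ≡-Reasoning
      entry : ∀ x → laplaceTerm (setCol M j x) j ≡ sgn (toℕ j) * (x zero * det (minor M j))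
      entry x = cong₂ (λ a d → sgn (toℕ j) * (a * d)) (setCol-at M j x zero) (det-cong (minor-setCol-at M j x))
    term j (no j≢b) = begin
      laplaceTerm (setCol M b w) j
        ≡⟨ entry w ⟩
      sgn (toℕ j) * (M zero j * det (setCol (minor M j) p (w ∘ suc)))
        ≡⟨ cong (λ d → sgn (toℕ j) * (M zero j * d)) (det-setCol-linear (minor M j) p (u ∘ suc) (v ∘ suc) t) ⟩
      sgn (toℕ j) * (M zero j * (det (setCol (minor M j) p (u ∘ suc)) + t * det (setCol (minor M j) p (v ∘ suc))))
        ≡⟨ distribʳ t (sgn (toℕ j)) (M zero j) _ _ ⟩
      sgn (toℕ j) * (M zero j * det (setCol (minor M j) p (u ∘ suc)))
        + t * (sgn (toℕ j) * (M zero j * det (setCol (minor M j) p (v ∘ suc))))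
        ≡⟨ cong₂ (λ x y → x + t * y) (entry u) (entry v) ⟨
      laplaceTerm (setCol M b u) j + t * laplaceTerm (setCol M b v) j ∎
      where
      open ≡-Reasoning
      p = punchOut j≢b
      entry : ∀ x → laplaceTerm (setCol M b x) j ≡ sgn (toℕ j) * (M zero j * det (setCol (minor M j) p (x ∘ suc)))
      entry x = cong₂ (λ a d → sgn (toℕ j) * (a * d))
                      (setCol-off M j≢b x zero) (det-cong (minor-setCol-off M j≢b x))

  swapAdj : ∀ {n} → Fin n → Fin (suc n) → Fin (suc n)
  swapAdj zero    zero          = suc zero
  swapAdj zero    (suc zero)    = zero
  swapAdj zero    (suc (suc i)) = suc (suc i)
  swapAdj (suc p) zero          = zero
  swapAdj (suc p) (suc i)       = suc (swapAdj p i)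

  swapAdj-stable : ∀ {n} {A : Set} (p : Fin n) (f : Fin (suc n) → A) → f (inject₁ p) ≡ f (suc p) →
    ∀ i → f (swapAdj p i) ≡ f i
  swapAdj-stable zero    f e zero          = sym e
  swapAdj-stable zero    f e (suc zero)    = e
  swapAdj-stable zero    f e (suc (suc i)) = refl
  swapAdj-stable (suc p) f e zero          = refl
  swapAdj-stable (suc p) f e (suc i)       = swapAdj-stable p (f ∘ suc) e i

  sumFin-swapAdj : ∀ {n} (p : Fin n) (f : Fin (suc n) → ℤ) → sumFin (f ∘ swapAdj p) ≡ sumFin f
  sumFin-swapAdj {suc n} zero    f = exchange (f (suc zero)) (f zero) (sumFin (λ i → f (suc (suc i))))
    where
    exchange : ∀ a b s → a + (b + s) ≡ b + (a + s)
    exchange = solve-∀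
  sumFin-swapAdj {suc n} (suc p) f = cong (_+_ (f zero)) (sumFin-swapAdj p (f ∘ suc))

  -- The pairs (j , c) and (punchIn j c , c′) with punchIn (punchIn j c) c′ ≡ j select the same two columns in
  -- the opposite order; this pairing is an involution on the index set of the double sum.
  sumFin²-pairing : ∀ {m} (g h : Fin (suc m) → Fin m → ℤ) →
    (∀ j c c′ → punchIn (punchIn j c) c′ ≡ j → g j c ≡ h (punchIn j c) c′) →
    sumFin (λ j → sumFin (g j)) ≡ sumFin (λ j → sumFin (h j))
  sumFin²-pairing {zero}  g h pair = refl
  sumFin²-pairing {suc m} g h pair = begin
    sumFin (g zero) + sumFin (λ j → g (suc j) zero + sumFin (λ c → g (suc j) (suc c)))
      ≡⟨ cong (_+_ (sumFin (g zero))) (sumFin-+ (λ j → g (suc j) zero) (λ j → sumFin (λ c → g (suc j) (suc c)))) ⟩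
    sumFin (g zero) + (sumFin (λ j → g (suc j) zero) + sumFin (λ j → sumFin (λ c → g (suc j) (suc c))))
      ≡⟨ cong₂ (λ x y → x + (y + _)) (sumFin-cong λ c → pair zero c zero refl)
                                     (sumFin-cong λ j → pair (suc j) zero j refl) ⟩
    sumFin (λ c → h (suc c) zero) + (sumFin (h zero) + sumFin (λ j → sumFin (λ c → g (suc j) (suc c))))
      ≡⟨ cong (λ x → sumFin (λ c → h (suc c) zero) + (sumFin (h zero) + x))
              (sumFin²-pairing (λ j c → g (suc j) (suc c)) (λ j c → h (suc j) (suc c))
                               λ j c c′ e → pair (suc j) (suc c) (suc c′) (cong suc e)) ⟩
    sumFin (λ c → h (suc c) zero) + (sumFin (h zero) + sumFin (λ j → sumFin (λ c → h (suc j) (suc c))))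
      ≡⟨ exchange (sumFin (λ c → h (suc c) zero)) (sumFin (h zero)) _ ⟩
    sumFin (h zero) + (sumFin (λ c → h (suc c) zero) + sumFin (λ j → sumFin (λ c → h (suc j) (suc c))))
      ≡⟨ cong (_+_ (sumFin (h zero))) (sumFin-+ (λ j → h (suc j) zero) (λ j → sumFin (λ c → h (suc j) (suc c)))) ⟨
    sumFin (h zero) + sumFin (λ j → h (suc j) zero + sumFin (λ c → h (suc j) (suc c))) ∎
    where
    open ≡-Reasoning
    exchange : ∀ a b s → a + (b + s) ≡ b + (a + s)
    exchange = solve-∀

  sgn-punchIn-pair : ∀ {m} (j : Fin (suc (suc m))) c c′ → punchIn (punchIn j c) c′ ≡ j →
    sgn (toℕ j) * sgn (toℕ c) ≡ - (sgn (toℕ (punchIn j c)) * sgn (toℕ c′))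
  sgn-punchIn-pair zero    c       zero    e = flip (sgn (toℕ c))
    where
    flip : ∀ s → + 1 * s ≡ - ((- s) * + 1)
    flip = solve-∀
  sgn-punchIn-pair (suc j) zero    c′      refl = flip (sgn (toℕ c′))
    where
    flip : ∀ s → (- s) * + 1 ≡ - (+ 1 * s)
    flip = solve-∀
  sgn-punchIn-pair {suc m} (suc j) (suc c) (suc c′) e =
    trans (negate² (sgn (toℕ j)) (sgn (toℕ c)))
          (trans (sgn-punchIn-pair j c c′ (suc-injective e))
                 (cong -_ (sym (negate² (sgn (toℕ (punchIn j c))) (sgn (toℕ c′))))))
    where
    negate² : ∀ a b → (- a) * (- b) ≡ a * b
    negate² = solve-∀

  punchIn-punchIn-pair : ∀ {m} (j : Fin (suc (suc m))) c c′ → punchIn (punchIn j c) c′ ≡ j →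
    ∀ x → punchIn j (punchIn c x) ≡ punchIn (punchIn j c) (punchIn c′ x)
  punchIn-punchIn-pair zero    c       zero    e    x = refl
  punchIn-punchIn-pair (suc j) zero    c′      refl x = refl
  punchIn-punchIn-pair {suc m} (suc j) (suc c) (suc c′) e zero    = refl
  punchIn-punchIn-pair {suc m} (suc j) (suc c) (suc c′) e (suc x) =
    cong suc (punchIn-punchIn-pair j c c′ (suc-injective e) x)

  det-expand₂ : ∀ {n} (M : Matrix (suc (suc n))) → det M ≡
    sumFin (λ j → sumFin (λ c → (sgn (toℕ j) * sgn (toℕ c))
                                  * (M zero j * M (suc zero) (punchIn j c) * det (minor (minor M j) c))))
  det-expand₂ M = sumFin-cong λ j → begin
    sgn (toℕ j) * (M zero j * sumFin (λ c → sgn (toℕ c) * (M (suc zero) (punchIn j c) * D j c)))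
      ≡⟨ cong (sgn (toℕ j) *_) (sumFin-* (M zero j) λ c → sgn (toℕ c) * (M (suc zero) (punchIn j c) * D j c)) ⟨
    sgn (toℕ j) * sumFin (λ c → M zero j * (sgn (toℕ c) * (M (suc zero) (punchIn j c) * D j c)))
      ≡⟨ sumFin-* (sgn (toℕ j)) (λ c → M zero j * (sgn (toℕ c) * (M (suc zero) (punchIn j c) * D j c))) ⟨
    sumFin (λ c → sgn (toℕ j) * (M zero j * (sgn (toℕ c) * (M (suc zero) (punchIn j c) * D j c))))
      ≡⟨ sumFin-cong (λ c → rearrange (sgn (toℕ j)) (sgn (toℕ c)) (M zero j) (M (suc zero) (punchIn j c)) (D j c)) ⟩
    sumFin (λ c → (sgn (toℕ j) * sgn (toℕ c)) * (M zero j * M (suc zero) (punchIn j c) * D j c)) ∎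
    where
    open ≡-Reasoning
    D = λ j c → det (minor (minor M j) c)
    rearrange : ∀ s s′ a b d → s * (a * (s′ * (b * d))) ≡ (s * s′) * (a * b * d)
    rearrange = solve-∀

  det-swap₀₁ : ∀ {n} (M : Matrix (suc (suc n))) → det (λ i → M (swapAdj zero i)) ≡ - det M
  det-swap₀₁ M = begin
    det (λ i → M (swapAdj zero i))          ≡⟨ det-expand₂ (λ i → M (swapAdj zero i)) ⟩
    sumFin (λ j → sumFin (g j))             ≡⟨ sumFin²-pairing g (λ j c → - t j c) pair ⟩
    sumFin (λ j → sumFin (λ c → - t j c))   ≡⟨ sumFin-cong (λ j → sumFin-neg (t j)) ⟩
    sumFin (λ j → - sumFin (t j))           ≡⟨ sumFin-neg (λ j → sumFin (t j)) ⟩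
    - sumFin (λ j → sumFin (t j))           ≡⟨ cong -_ (det-expand₂ M) ⟨
    - det M                                 ∎
    where
    open ≡-Reasoning
    D = λ j c → det (minor (minor M j) c)
    t g : Fin _ → Fin _ → ℤ
    t j c = (sgn (toℕ j) * sgn (toℕ c)) * (M zero j * M (suc zero) (punchIn j c) * D j c)
    g j c = (sgn (toℕ j) * sgn (toℕ c)) * (M (suc zero) j * M zero (punchIn j c) * D j c)
    flip : ∀ s s′ x y d → s ≡ - s′ → s * (x * y * d) ≡ - (s′ * (y * x * d))
    flip s s′ x y d refl = negate s′ x y d
      where
      negate : ∀ s′ x y d → (- s′) * (x * y * d) ≡ - (s′ * (y * x * d))
      negate = solve-∀
    pair : ∀ j c c′ → punchIn (punchIn j c) c′ ≡ j → g j c ≡ - t (punchIn j c) c′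
    pair j c c′ e = trans (flip _ _ (M (suc zero) j) (M zero (punchIn j c)) (D j c) (sgn-punchIn-pair j c c′ e))
      (cong (λ z → - ((sgn (toℕ (punchIn j c)) * sgn (toℕ c′)) * z))
            (cong₂ (λ a d → M zero (punchIn j c) * a * d) (cong (M (suc zero)) (sym e))
                   (det-cong λ r x → cong (M (suc (suc r))) (punchIn-punchIn-pair j c c′ e x))))

  det-swapRows : ∀ {n} (p : Fin n) (M : Matrix (suc n)) → det (λ i → M (swapAdj p i)) ≡ - det M
  det-swapRows zero    M = det-swap₀₁ M
  det-swapRows (suc p) M = trans
    (sumFin-cong λ j → trans (cong (λ d → sgn (toℕ j) * (M zero j * d)) (det-swapRows p (minor M j)))
                             (negate (sgn (toℕ j)) (M zero j) (det (minor M j))))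
    (sumFin-neg (laplaceTerm M))
    where
    negate : ∀ s a d → s * (a * (- d)) ≡ - (s * (a * d))
    negate = solve-∀

  -- Either j is one of the two swapped positions and deleting it commutes with the swap, or deleting j turns the
  -- swap into a swap of two adjacent positions q, q + 1 of the remaining indices.
  swapAdj-punchIn : ∀ {n} (p : Fin (suc n)) (j : Fin (suc (suc n))) →
      (sgn (toℕ (swapAdj p j)) ≡ - sgn (toℕ j) × (∀ x → swapAdj p (punchIn j x) ≡ punchIn (swapAdj p j) x))
    ⊎ Σ (Fin n) λ q → sgn (toℕ (swapAdj p j)) ≡ sgn (toℕ j)
                     × (∀ x → swapAdj p (punchIn j x) ≡ punchIn (swapAdj p j) (swapAdj q x))
  swapAdj-punchIn zero zero       = inj₁ (refl , λ { zero → refl ; (suc x) → refl })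
  swapAdj-punchIn zero (suc zero) = inj₁ (refl , λ { zero → refl ; (suc x) → refl })
  swapAdj-punchIn {suc n} zero (suc (suc j)) =
    inj₂ (zero , refl , λ { zero → refl ; (suc zero) → refl ; (suc (suc x)) → refl })
  swapAdj-punchIn {suc n} (suc p) zero = inj₂ (p , refl , λ x → refl)
  swapAdj-punchIn {suc n} (suc p) (suc j) with swapAdj-punchIn p j
  ... | inj₁ (s , e)     = inj₁ (cong -_ s , λ { zero → refl ; (suc x) → cong suc (e x) })
  ... | inj₂ (q , s , e) = inj₂ (suc q , cong -_ s , λ { zero → refl ; (suc x) → cong suc (e x) })

  det-swapCols : ∀ {n} (p : Fin n) (M : Matrix (suc n)) → det (λ i j → M i (swapAdj p j)) ≡ - det M
  det-swapCols {suc n} p M = begin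
    sumFin (λ j → sgn (toℕ j) * (M zero (swapAdj p j) * det (λ r c → M (suc r) (swapAdj p (punchIn j c)))))
      ≡⟨ sumFin-cong term ⟩
    sumFin (λ j → - laplaceTerm M (swapAdj p j))
      ≡⟨ sumFin-neg (laplaceTerm M ∘ swapAdj p) ⟩
    - sumFin (laplaceTerm M ∘ swapAdj p)
      ≡⟨ cong -_ (sumFin-swapAdj p (laplaceTerm M)) ⟩
    - det M ∎
    where
    open ≡-Reasoning
    term : ∀ j → sgn (toℕ j) * (M zero (swapAdj p j) * det (λ r c → M (suc r) (swapAdj p (punchIn j c))))
               ≡ - laplaceTerm M (swapAdj p j)
    term j with swapAdj-punchIn p j
    ... | inj₁ (s , e) = begin
      sgn (toℕ j) * (a * det (λ r c → M (suc r) (swapAdj p (punchIn j c))))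
        ≡⟨ cong (λ d → sgn (toℕ j) * (a * d)) (det-cong λ r c → cong (M (suc r)) (e c)) ⟩
      sgn (toℕ j) * (a * d)
        ≡⟨ cong (λ s′ → s′ * (a * d)) (trans (cong -_ s) (neg-involutive _)) ⟨
      - sgn (toℕ (swapAdj p j)) * (a * d)
        ≡⟨ negate (sgn (toℕ (swapAdj p j))) (a * d) ⟩
      - laplaceTerm M (swapAdj p j) ∎
      where
      a = M zero (swapAdj p j)
      d = det (minor M (swapAdj p j))
      negate : ∀ s x → (- s) * x ≡ - (s * x)
      negate = solve-∀
    ... | inj₂ (q , s , e) = begin
      sgn (toℕ j) * (a * det (λ r c → M (suc r) (swapAdj p (punchIn j c))))
        ≡⟨ cong (λ d → sgn (toℕ j) * (a * d)) (det-cong λ r c → cong (M (suc r)) (e c)) ⟩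
      sgn (toℕ j) * (a * det (λ r c → minor M (swapAdj p j) r (swapAdj q c)))
        ≡⟨ cong₂ (λ s′ d → s′ * (a * d)) (sym s) (det-swapCols q (minor M (swapAdj p j))) ⟩
      sgn (toℕ (swapAdj p j)) * (a * - det (minor M (swapAdj p j)))
        ≡⟨ negate (sgn (toℕ (swapAdj p j))) a _ ⟩
      - laplaceTerm M (swapAdj p j) ∎
      where
      a = M zero (swapAdj p j)
      negate : ∀ s a d → s * (a * - d) ≡ - (s * (a * d))
      negate = solve-∀

  det-swapAdj : ∀ {n} (p : Fin n) (M : Matrix (suc n)) → det (λ i j → M (swapAdj p i) (swapAdj p j)) ≡ det M
  det-swapAdj p M = begin
    det (λ i j → M (swapAdj p i) (swapAdj p j))  ≡⟨ det-swapRows p (λ i j → M i (swapAdj p j)) ⟩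
    - det (λ i j → M i (swapAdj p j))            ≡⟨ cong -_ (det-swapCols p M) ⟩
    - - det M                                    ≡⟨ neg-involutive (det M) ⟩
    det M                                        ∎
    where open ≡-Reasoning

  -- Elementary operations are only needed between adjacent lines, where equal lines are handled by one swap.
  data Adjacent {n} : Fin (suc n) → Fin (suc n) → Set where
    inject₁-suc : (p : Fin n) → Adjacent (inject₁ p) (suc p)
    suc-inject₁ : (p : Fin n) → Adjacent (suc p) (inject₁ p)

  adjacent⇒≢ : ∀ {n} {a b : Fin (suc n)} → Adjacent a b → a ≢ b
  adjacent⇒≢ (inject₁-suc p) = inject₁≢suc p
    where
    inject₁≢suc : ∀ {n} (p : Fin n) → inject₁ p ≢ suc p
    inject₁≢suc (suc p) e = inject₁≢suc p (suc-injective e)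
  adjacent⇒≢ (suc-inject₁ p) = adjacent⇒≢ (inject₁-suc p) ∘ sym

  i≡-i⇒i≡0 : ∀ i → i ≡ - i → i ≡ + 0
  i≡-i⇒i≡0 (+ zero) _ = refl

  det-equalRows : ∀ {n} {a b : Fin (suc n)} → Adjacent a b → (M : Matrix (suc n)) →
    (∀ j → M a j ≡ M b j) → det M ≡ + 0
  det-equalRows (inject₁-suc p) M e = i≡-i⇒i≡0 (det M) (begin
    det M                        ≡⟨ det-cong (λ i j → swapAdj-stable p (λ i → M i j) (e j) i) ⟨
    det (λ i → M (swapAdj p i))  ≡⟨ det-swapRows p M ⟩
    - det M                      ∎)
    where open ≡-Reasoning
  det-equalRows (suc-inject₁ p) M e = det-equalRows (inject₁-suc p) M (sym ∘ e)

  det-equalCols : ∀ {n} {a b : Fin (suc n)} → Adjacent a b → (M : Matrix (suc n)) →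
    (∀ i → M i a ≡ M i b) → det M ≡ + 0
  det-equalCols (inject₁-suc p) M e = i≡-i⇒i≡0 (det M) (begin
    det M                            ≡⟨ det-cong (λ i → swapAdj-stable p (M i) (e i)) ⟨
    det (λ i j → M i (swapAdj p j))  ≡⟨ det-swapCols p M ⟩
    - det M                          ∎)
    where open ≡-Reasoning
  det-equalCols (suc-inject₁ p) M e = det-equalCols (inject₁-suc p) M (sym ∘ e)

  addRow : ∀ {n} → Fin n → Fin n → ℤ → Matrix n → Matrix n
  addRow a b t M = setRow M b (λ j → M b j + t * M a j)

  addCol : ∀ {n} → Fin n → Fin n → ℤ → Matrix n → Matrix n
  addCol a b t M = setCol M b (λ i → M i b + t * M i a)

  private
    plus-zero : ∀ x t → x + t * + 0 ≡ x
    plus-zero = solve-∀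

  det-addRow : ∀ {n} {a b : Fin (suc n)} → Adjacent a b → ∀ t (M : Matrix (suc n)) →
    det (addRow a b t M) ≡ det M
  det-addRow {a = a} {b} adj t M = begin
    det (addRow a b t M)
      ≡⟨ det-setRow-linear M b (M b) (M a) t ⟩
    det (setRow M b (M b)) + t * det (setRow M b (M a))
      ≡⟨ cong₂ (λ x y → x + t * y) (det-cong (setRow-self M b)) (det-equalRows adj (setRow M b (M a)) rows-equal) ⟩
    det M + t * + 0
      ≡⟨ plus-zero (det M) t ⟩
    det M ∎
    where
    open ≡-Reasoning
    rows-equal : ∀ j → setRow M b (M a) a j ≡ setRow M b (M a) b j
    rows-equal j = trans (setRow-off M (adjacent⇒≢ adj) (M a) j) (sym (setRow-at M b (M a) j))

  det-addCol : ∀ {n} {a b : Fin (suc n)} → Adjacent a b → ∀ t (M : Matrix (suc n)) →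
    det (addCol a b t M) ≡ det M
  det-addCol {a = a} {b} adj t M = begin
    det (addCol a b t M)
      ≡⟨ det-setCol-linear M b (λ i → M i b) (λ i → M i a) t ⟩
    det (setCol M b (λ i → M i b)) + t * det (setCol M b (λ i → M i a))
      ≡⟨ cong₂ (λ x y → x + t * y) (det-cong (setCol-self M b))
                                   (det-equalCols adj (setCol M b (λ i → M i a)) cols-equal) ⟩
    det M + t * + 0
      ≡⟨ plus-zero (det M) t ⟩
    det M ∎
    where
    open ≡-Reasoning
    cols-equal : ∀ i → setCol M b (λ i → M i a) i a ≡ setCol M b (λ i → M i a) i b
    cols-equal i = trans (setCol-off M (adjacent⇒≢ adj) (λ i → M i a) i) (sym (setCol-at M b (λ i → M i a) i))


module Bordered where

  open import Data.Nat.Base as ℕ using (ℕ; zero; suc; _<ᵇ_; _%_)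
  import Data.Nat.Properties as ℕ
  open import Data.Nat.DivMod using (m%n<n)
  open import Data.Fin.Base using (Fin; zero; suc; toℕ)
  open import Data.Integer.Base using (ℤ; +_; -[1+_]; -_; _+_; _*_; _-_; ∣_∣; _≤_; +≤+)
  open import Data.Integer.Properties using (∣i-j∣≤∣i∣+∣j∣; +◃n≡+n; pos-*; neg-involutive; module ≤-Reasoning)
  open import Data.Integer.Tactic.RingSolver using (solve-∀)
  open import Data.Empty using (⊥-elim)
  open import Function.Base using (_∘_)
  open import Relation.Binary.PropositionalEquality
  open Determinant

  transitive : (m : ℕ) → Arcs m
  transitive m i j = toℕ i <ᵇ toℕ j

  -- The skew matrix of a tournament consisting of a first vertex followed by a transitive tournament, with the
  -- first column (c i in row suc i) generalised to arbitrary integers.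
  bordered : (m : ℕ) → (Fin m → ℤ) → Matrix (suc m)
  bordered m c zero    zero    = + 0
  bordered m c zero    (suc j) = - c j
  bordered m c (suc i) zero    = c i
  bordered m c (suc i) (suc j) = skew (transitive m) i j

  altSum : ∀ {m} → (Fin m → ℤ) → ℤ
  altSum {zero}  c = + 0
  altSum {suc m} c = c zero - altSum (c ∘ suc)

  altSum-cong : ∀ {m} {c c′ : Fin m → ℤ} → (∀ i → c i ≡ c′ i) → altSum c ≡ altSum c′
  altSum-cong {zero}  e = refl
  altSum-cong {suc m} e = cong₂ _-_ (e zero) (altSum-cong (e ∘ suc))

  altSum-neg : ∀ {m} (c : Fin m → ℤ) → altSum (λ i → - c i) ≡ - altSum c
  altSum-neg {zero}  c = refl
  altSum-neg {suc m} c = trans (cong (λ x → - c zero - x) (altSum-neg (c ∘ suc))) (distrib (c zero) (altSum (c ∘ suc)))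
    where
    distrib : ∀ a A → - a - - A ≡ - (a - A)
    distrib = solve-∀

  altSum-+ : ∀ {m} (c : Fin m → ℤ) d → altSum (λ i → c i + d) ≡ altSum c + + (m % 2) * d
  altSum-+ {zero}        c d = refl
  altSum-+ {suc zero}    c d = shift (c zero) d
    where
    shift : ∀ a d → (a + d) - + 0 ≡ (a - + 0) + + 1 * d
    shift = solve-∀
  altSum-+ {suc (suc m)} c d =
    trans (cong (λ A → (c zero + d) - ((c (suc zero) + d) - A)) (altSum-+ (λ i → c (suc (suc i))) d))
          (shift (c zero) (c (suc zero)) (altSum (λ i → c (suc (suc i)))) (+ (m % 2)) d)
    where
    shift : ∀ a b A p d → (a + d) - ((b + d) - (A + p * d)) ≡ (a - (b - A)) + p * d
    shift = solve-∀

  altSum-sgn : ∀ m → altSum {m} (λ i → sgn (toℕ i)) ≡ + m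
  altSum-sgn zero    = refl
  altSum-sgn (suc m) = trans (cong (_-_ (+ 1)) (trans (altSum-neg {m} (λ i → sgn (toℕ i))) (cong -_ (altSum-sgn m))))
                             (cong (_+_ (+ 1)) (neg-involutive (+ m)))

  ∣altSum∣≤ : ∀ {m} (c : Fin m → ℤ) → (∀ i → ∣ c i ∣ ℕ.≤ 1) → ∣ altSum c ∣ ℕ.≤ m
  ∣altSum∣≤ {zero}  c bound = ℕ.z≤n
  ∣altSum∣≤ {suc m} c bound = ℕ.≤-trans (∣i-j∣≤∣i∣+∣j∣ (c zero) (altSum (c ∘ suc)))
                                        (ℕ.+-mono-≤ (bound zero) (∣altSum∣≤ (c ∘ suc) (bound ∘ suc)))

  -- Deleting the first two vertices b₀, b₁ of the transitive part: reorder the vertices s, b₀, b₁, b₂, … as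
  -- b₀, b₁, s, b₂, …, clear rows and columns 0 and 1 by four elementary operations, and expand twice along the
  -- first row.
  module Reduction (m : ℕ) (c : Fin (suc (suc m)) → ℤ) where

    d : ℤ
    d = c zero - c (suc zero)

    c′ : Fin m → ℤ
    c′ r = c (suc (suc r)) + d

    reordered : Matrix (suc (suc (suc m)))
    reordered i j =
      bordered (suc (suc m)) c (swapAdj zero (swapAdj (suc zero) i)) (swapAdj zero (swapAdj (suc zero) j))

    cleared : Matrix (suc (suc (suc m)))
    cleared zero                (suc zero)          = + 1
    cleared zero                _                   = + 0
    cleared (suc zero)          zero                = - + 1
    cleared (suc zero)          (suc zero)          = + 0
    cleared (suc zero)          (suc (suc zero))    = c (suc zero)
    cleared (suc zero)          (suc (suc (suc x))) = + 1
    cleared (suc (suc zero))    (suc zero)          = - c (suc zero)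
    cleared (suc (suc zero))    (suc (suc (suc x))) = - c′ x
    cleared (suc (suc zero))    _                   = + 0
    cleared (suc (suc (suc r))) zero                = + 0
    cleared (suc (suc (suc r))) (suc zero)          = - + 1
    cleared (suc (suc (suc r))) (suc (suc zero))    = c′ r
    cleared (suc (suc (suc r))) (suc (suc (suc x))) = skew (transitive m) r x

    one two : Fin (suc (suc (suc m)))
    one = suc zero
    two = suc (suc zero)

    operations≗cleared : ∀ i j →
      addRow one two (- d) (addCol one two (- d) (addCol one zero (- + 1) (addRow one zero (- + 1) reordered))) i j
      ≡ cleared i j
    operations≗cleared zero                zero                = refl
    operations≗cleared zero                (suc zero)          = refl
    operations≗cleared zero                (suc (suc zero))    = e (c zero) (c (suc zero))
      where
      e : ∀ a b → (a + - + 1 * b) + - (a - b) * (+ 1 + - + 1 * + 0) ≡ + 0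
      e = solve-∀
    operations≗cleared zero                (suc (suc (suc x))) = refl
    operations≗cleared (suc zero)          zero                = refl
    operations≗cleared (suc zero)          (suc zero)          = refl
    operations≗cleared (suc zero)          (suc (suc zero))    = e (c zero) (c (suc zero))
      where
      e : ∀ a b → b + - (a - b) * + 0 ≡ b
      e = solve-∀
    operations≗cleared (suc zero)          (suc (suc (suc x))) = refl
    operations≗cleared (suc (suc zero))    zero                = e (c zero) (c (suc zero))
      where
      e : ∀ a b → (- a + - + 1 * - b) + - (a - b) * (- + 1 + - + 1 * + 0) ≡ + 0
      e = solve-∀
    operations≗cleared (suc (suc zero))    (suc zero)          = e (c zero) (c (suc zero))
      where
      e : ∀ a b → - b + - (a - b) * + 0 ≡ - b
      e = solve-∀
    operations≗cleared (suc (suc zero))    (suc (suc zero))    = e (c zero) (c (suc zero))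
      where
      e : ∀ a b → (+ 0 + - (a - b) * - b) + - (a - b) * (b + - (a - b) * + 0) ≡ + 0
      e = solve-∀
    operations≗cleared (suc (suc zero))    (suc (suc (suc x))) = e (c zero) (c (suc zero)) (c (suc (suc x)))
      where
      e : ∀ a b cₓ → - cₓ + - (a - b) * + 1 ≡ - (cₓ + (a - b))
      e = solve-∀
    operations≗cleared (suc (suc (suc r))) zero                = refl
    operations≗cleared (suc (suc (suc r))) (suc zero)          = refl
    operations≗cleared (suc (suc (suc r))) (suc (suc zero))    = e (c zero) (c (suc zero)) (c (suc (suc r)))
      where
      e : ∀ a b cᵣ → cᵣ + - (a - b) * - + 1 ≡ cᵣ + (a - b)
      e = solve-∀
    operations≗cleared (suc (suc (suc r))) (suc (suc (suc x))) = refl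

    det-cleared : det cleared ≡ det (bordered m c′)
    det-cleared = begin
      det cleared
        ≡⟨ det≡laplaceTerm cleared one (λ { zero _ → refl ; (suc zero) 1≢1 → ⊥-elim (1≢1 refl)
                                          ; (suc (suc zero)) _ → refl ; (suc (suc (suc x))) _ → refl }) ⟩
      - + 1 * (+ 1 * det Q)
        ≡⟨ cong (λ q → - + 1 * (+ 1 * q)) det-Q ⟩
      - + 1 * (+ 1 * (+ 1 * (- + 1 * det (bordered m c′))))
        ≡⟨ simplify (det (bordered m c′)) ⟩
      det (bordered m c′) ∎
      where
      open ≡-Reasoning
      Q = minor cleared one
      simplify : ∀ x → - + 1 * (+ 1 * (+ 1 * (- + 1 * x))) ≡ x
      simplify = solve-∀
      vanish : ∀ s a → s * (a * + 0) ≡ + 0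
      vanish = solve-∀
      det-Q : det Q ≡ + 1 * (- + 1 * det (bordered m c′))
      det-Q = trans (sumFin-single (laplaceTerm Q) zero λ
                      { zero 0≢0 → ⊥-elim (0≢0 refl)
                      ; (suc j) _ → trans (cong (λ x → sgn (toℕ (suc j)) * (Q zero (suc j) * x))
                                                (det-zeroCol (minor Q (suc j)) λ { zero → refl ; (suc r) → refl }))
                                          (vanish (sgn (toℕ (suc j))) (Q zero (suc j))) })
                    (cong (λ x → + 1 * (- + 1 * x))
                          (det-cong {M = minor Q zero} {N = bordered m c′}
                            λ { zero zero → refl ; zero (suc x) → refl
                              ; (suc r) zero → refl ; (suc r) (suc x) → refl }))

    det-bordered-reduction : det (bordered (suc (suc m)) c) ≡ det (bordered m c′)
    det-bordered-reduction = begin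
      det (bordered (suc (suc m)) c)
        ≡⟨ det-swapAdj zero (bordered (suc (suc m)) c) ⟨
      det (λ i j → bordered (suc (suc m)) c (swapAdj zero i) (swapAdj zero j))
        ≡⟨ det-swapAdj (suc zero) (λ i j → bordered (suc (suc m)) c (swapAdj zero i) (swapAdj zero j)) ⟨
      det reordered
        ≡⟨ det-addRow one→zero (- + 1) reordered ⟨
      det (addRow one zero (- + 1) reordered)
        ≡⟨ det-addCol one→zero (- + 1) (addRow one zero (- + 1) reordered) ⟨
      det (addCol one zero (- + 1) (addRow one zero (- + 1) reordered))
        ≡⟨ det-addCol one→two (- d) (addCol one zero (- + 1) (addRow one zero (- + 1) reordered)) ⟨
      det (addCol one two (- d) (addCol one zero (- + 1) (addRow one zero (- + 1) reordered)))
        ≡⟨ det-addRow one→two (- d)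
                      (addCol one two (- d) (addCol one zero (- + 1) (addRow one zero (- + 1) reordered))) ⟨
      det (addRow one two (- d) (addCol one two (- d) (addCol one zero (- + 1) (addRow one zero (- + 1) reordered))))
        -- M is given explicitly: inferring it by unifying det M would unfold det of a concrete matrix.
        ≡⟨ det-cong {M = addRow one two (- d)
                           (addCol one two (- d) (addCol one zero (- + 1) (addRow one zero (- + 1) reordered)))}
                    operations≗cleared ⟩
      det cleared
        ≡⟨ det-cleared ⟩
      det (bordered m c′) ∎
      where
      open ≡-Reasoning
      one→zero : Adjacent one zero
      one→zero = suc-inject₁ zero
      one→two : Adjacent one two
      one→two = inject₁-suc (suc zero)

  -- p (A + p d)² = p (A + d)² because p² = p for p ∈ {0, 1}.
  private
    parity-absorb : ∀ p → p ℕ.< 2 → ∀ A d → + p * ((A + + p * d) * (A + + p * d)) ≡ + p * ((A + d) * (A + d))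
    parity-absorb zero          _ A d = refl
    parity-absorb (suc zero)    _ A d = absorb A d
      where
      absorb : ∀ A d → + 1 * ((A + + 1 * d) * (A + + 1 * d)) ≡ + 1 * ((A + d) * (A + d))
      absorb = solve-∀
    parity-absorb (suc (suc p)) (ℕ.s≤s (ℕ.s≤s ())) A d

  det-bordered : ∀ m (c : Fin m → ℤ) → det (bordered m c) ≡ + (m % 2) * (altSum c * altSum c)
  det-bordered zero          c = refl
  det-bordered (suc zero)    c = trans (det-2×2 (bordered 1 c)) (square (c zero))
    where
    square : ∀ a → + 0 * + 0 - (- a) * a ≡ + 1 * ((a - + 0) * (a - + 0))
    square = solve-∀
  det-bordered (suc (suc m)) c = begin
    det (bordered (suc (suc m)) c)         ≡⟨ det-bordered-reduction ⟩
    det (bordered m c′)                    ≡⟨ det-bordered m c′ ⟩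
    + p * (altSum c′ * altSum c′)          ≡⟨ cong (λ x → + p * (x * x)) (altSum-+ (λ i → c (suc (suc i))) d) ⟩
    + p * ((A + + p * d) * (A + + p * d))  ≡⟨ parity-absorb p (m%n<n m 2) A d ⟩
    + p * ((A + d) * (A + d))              ≡⟨ cong (λ x → + p * (x * x)) (regroup (c zero) (c (suc zero)) A) ⟩
    + p * (altSum c * altSum c)            ∎
    where
    open ≡-Reasoning
    open Reduction m c using (d; c′; det-bordered-reduction)
    p = m % 2
    A = altSum (λ i → c (suc (suc i)))
    regroup : ∀ a b A → A + (a - b) ≡ a - (b - A)
    regroup = solve-∀

  private
    i*i≡+∣i∣*∣i∣ : ∀ i → i * i ≡ + (∣ i ∣ ℕ.* ∣ i ∣)
    i*i≡+∣i∣*∣i∣ (+ n)    = +◃n≡+n (n ℕ.* n)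
    i*i≡+∣i∣*∣i∣ -[1+ n ] = +◃n≡+n (suc n ℕ.* suc n)

  det-bordered-≤ : ∀ m (c : Fin m → ℤ) → (∀ i → ∣ c i ∣ ℕ.≤ 1) → det (bordered m c) ≤ + (m ℕ.* m)
  det-bordered-≤ m c bound = begin
    det (bordered m c)                 ≡⟨ det-bordered m c ⟩
    + (m % 2) * (altSum c * altSum c)  ≡⟨ cong (+ (m % 2) *_) (i*i≡+∣i∣*∣i∣ (altSum c)) ⟩
    + (m % 2) * + (a ℕ.* a)            ≡⟨ pos-* (m % 2) (a ℕ.* a) ⟨
    + (m % 2 ℕ.* (a ℕ.* a))            ≤⟨ +≤+ (ℕ.*-mono-≤ (ℕ.s≤s⁻¹ (m%n<n m 2)) (ℕ.*-mono-≤ a≤m a≤m)) ⟩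
    + (1 ℕ.* (m ℕ.* m))                ≡⟨ cong +_ (ℕ.*-identityˡ (m ℕ.* m)) ⟩
    + (m ℕ.* m)                        ∎
    where
    open ≤-Reasoning
    a = ∣ altSum c ∣
    a≤m = ∣altSum∣≤ c bound


module Tournament where

  open import Data.Nat.Base as ℕ using (ℕ; zero; suc; z≤n; s≤s; _<ᵇ_; _%_; _≡ᵇ_)
  import Data.Nat.Properties as ℕ
  open import Data.Fin.Base as Fin using (Fin; zero; suc; toℕ; inject₁; fromℕ; _<_)
  import Data.Fin.Properties as Fin
  open import Data.Integer.Base using (ℤ; +_; -_; _*_; ∣_∣; _≤_)
  open import Data.Integer.Properties as ℤ using (neg-involutive; pos-*)
  open import Data.Integer.Tactic.RingSolver using (solve-∀)
  open import Data.Bool.Base using (Bool; true; false; not; if_then_else_)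
  open import Data.Bool.Properties using (not-involutive)
  open import Data.Product.Base using (Σ; _×_; _,_; proj₁; proj₂)
  open import Data.Vec.Functional using (_∷_)
  open import Function.Base using (_∘_; id)
  open import Function.Definitions using (Injective)
  open import Function.Bundles using (Inverse; Injection; mk↔ₛ′)
  open import Function.Properties.Inverse using (↔⇒↣)
  open import Data.Fin.Permutation using (↔⇒≡)
  open import Relation.Binary.Core using (_Preserves_⟶_)
  open import Relation.Binary.Definitions using (tri<; tri≈; tri>)
  open import Relation.Nullary using (Dec; yes; no; does; ¬_)
  open import Relation.Nullary.Decidable using (dec-true; dec-false)
  open import Relation.Nullary.Negation using (contradiction)
  open import Relation.Binary.PropositionalEquality
  open Determinant
  open Bordered

  private
    <ᵇ≡true : ∀ {m n} → m ℕ.< n → (m <ᵇ n) ≡ true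
    <ᵇ≡true m<n = dec-true (_ ℕ.<? _) m<n

    <ᵇ≡false : ∀ {m n} → ¬ m ℕ.< n → (m <ᵇ n) ≡ false
    <ᵇ≡false m≮n = dec-false (_ ℕ.<? _) m≮n

  arcSign : Bool → ℤ
  arcSign b = if b then + 1 else - + 1

  IsTournament : ∀ {n} → Arcs n → Set
  IsTournament T = ∀ {i j} → i ≢ j → T j i ≡ not (T i j)

  induced-isTournament : ∀ {n k} {T : Arcs n} {f : Fin k → Fin n} →
    IsTournament T → Injective _≡_ _≡_ f → IsTournament (induced T f)
  induced-isTournament tour inj i≢j = tour (i≢j ∘ inj)

  skew-diag : ∀ {n} (T : Arcs n) i → skew T i i ≡ + 0
  skew-diag T i = cong (λ b → if b then + 0 else arcSign (T i i)) (dec-true (i Fin.≟ i) refl)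

  skew-antisym : ∀ {n} {T : Arcs n} → IsTournament T → ∀ i j → skew T j i ≡ - skew T i j
  skew-antisym {T = T} tour i j = by (i Fin.≟ j)
    where
    arc-not : ∀ b → arcSign (not b) ≡ - arcSign b
    arc-not true  = refl
    arc-not false = refl
    off-diag : ∀ {i j} → i ≢ j → skew T i j ≡ arcSign (T i j)
    off-diag {i} {j} i≢j = cong (λ b → if b then + 0 else arcSign (T i j)) (dec-false (i Fin.≟ j) i≢j)
    by : Dec (i ≡ j) → skew T j i ≡ - skew T i j
    by (yes refl) = trans (skew-diag T i) (cong -_ (sym (skew-diag T i)))
    by (no i≢j)   = begin
      skew T j i            ≡⟨ off-diag (i≢j ∘ sym) ⟩
      arcSign (T j i)       ≡⟨ cong arcSign (tour i≢j) ⟩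
      arcSign (not (T i j)) ≡⟨ arc-not (T i j) ⟩
      - arcSign (T i j)     ≡⟨ cong -_ (off-diag i≢j) ⟨
      - skew T i j          ∎
      where open ≡-Reasoning

  does-≟-injective : ∀ {k n} {f : Fin k → Fin n} → Injective _≡_ _≡_ f →
    ∀ i j → does (f i Fin.≟ f j) ≡ does (i Fin.≟ j)
  does-≟-injective {f = f} inj i j with i Fin.≟ j
  ... | yes refl = dec-true (f i Fin.≟ f i) refl
  ... | no i≢j   = dec-false (f i Fin.≟ f j) (i≢j ∘ inj)

  skew-induced : ∀ {k n} (T : Arcs n) {f : Fin k → Fin n} → Injective _≡_ _≡_ f →
    ∀ i j → skew (induced T f) i j ≡ skew T (f i) (f j)
  skew-induced T {f} inj i j =
    cong (λ b → if b then + 0 else arcSign (T (f i) (f j))) (sym (does-≟-injective inj i j))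

  skew-bordered : ∀ {m} {T : Arcs (suc m)} → IsTournament T → (∀ i j → T (suc i) (suc j) ≡ transitive m i j) →
    ∀ i j → skew T i j ≡ bordered m (λ i → skew T (suc i) zero) i j
  skew-bordered tour trans-tail zero    zero    = refl
  skew-bordered tour trans-tail zero    (suc j) = skew-antisym tour (suc j) zero
  skew-bordered tour trans-tail (suc i) zero    = refl
  skew-bordered tour trans-tail (suc i) (suc j) =
    cong (λ b → if does (i Fin.≟ j) then + 0 else arcSign b) (trans-tail i j)

  Increasing : ∀ {k n} → (Fin k → Fin n) → Set
  Increasing h = h Preserves _<_ ⟶ _<_

  ∷-increasing : ∀ {k n} {x : Fin n} {h : Fin k → Fin n} → (∀ j → x < h j) → Increasing h → Increasing (x ∷ h)
  ∷-increasing x<h inc {zero}  {suc j} _         = x<h j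
  ∷-increasing x<h inc {suc i} {suc j} (s≤s i<j) = inc i<j

  increasing-<ᵇ : ∀ {k n} {h : Fin k → Fin n} → Increasing h → ∀ i j → (toℕ (h i) <ᵇ toℕ (h j)) ≡ (toℕ i <ᵇ toℕ j)
  increasing-<ᵇ {h = h} inc i j with ℕ.<-cmp (toℕ i) (toℕ j)
  ... | tri< i<j _ _ = trans (<ᵇ≡true (inc i<j)) (sym (<ᵇ≡true i<j))
  ... | tri≈ _ i≡j _ with refl ← Fin.toℕ-injective {i = i} {j} i≡j =
    trans (<ᵇ≡false {toℕ (h i)} (ℕ.<-irrefl refl)) (sym (<ᵇ≡false {toℕ i} (ℕ.<-irrefl refl)))
  ... | tri> _ _ j<i = trans (<ᵇ≡false (ℕ.<⇒≯ (inc j<i))) (sym (<ᵇ≡false (ℕ.<⇒≯ j<i)))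

  increasing⇒injective : ∀ {k n} {h : Fin k → Fin n} → Increasing h → Injective _≡_ _≡_ h
  increasing⇒injective {h = h} inc {i} {j} hi≡hj with ℕ.<-cmp (toℕ i) (toℕ j)
  ... | tri< i<j _ _ = contradiction (cong toℕ hi≡hj) (ℕ.<⇒≢ (inc i<j))
  ... | tri≈ _ i≡j _ = Fin.toℕ-injective i≡j
  ... | tri> _ _ j<i = contradiction (cong toℕ (sym hi≡hj)) (ℕ.<⇒≢ (inc j<i))

  increasing-lower : ∀ {k n} (h : Fin (suc k) → Fin n) → Increasing h → ∀ i → toℕ (h zero) ℕ.+ toℕ i ℕ.≤ toℕ (h i)
  increasing-lower h inc zero = ℕ.≤-reflexive (ℕ.+-identityʳ _)
  increasing-lower {suc k} h inc (suc i) = begin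
    toℕ (h zero) ℕ.+ suc (toℕ i)   ≡⟨ ℕ.+-suc (toℕ (h zero)) (toℕ i) ⟩
    suc (toℕ (h zero) ℕ.+ toℕ i)   ≤⟨ ℕ.+-monoˡ-≤ (toℕ i) (inc {zero} {suc zero} (s≤s z≤n)) ⟩
    toℕ (h (suc zero)) ℕ.+ toℕ i   ≤⟨ increasing-lower (h ∘ suc) (λ x<y → inc (s≤s x<y)) i ⟩
    toℕ (h (suc i))                ∎
    where open ℕ.≤-Reasoning

  increasing-upper : ∀ {k n} (h : Fin k → Fin n) → Increasing h → ∀ i → toℕ (h i) ℕ.+ k ℕ.≤ n ℕ.+ toℕ i
  increasing-upper {suc zero} {n} h inc zero = begin
    toℕ (h zero) ℕ.+ 1   ≡⟨ ℕ.+-comm (toℕ (h zero)) 1 ⟩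
    suc (toℕ (h zero))   ≤⟨ Fin.toℕ<n (h zero) ⟩
    n                    ≡⟨ ℕ.+-identityʳ n ⟨
    n ℕ.+ 0              ∎
    where open ℕ.≤-Reasoning
  increasing-upper {suc (suc k)} {n} h inc zero = begin
    toℕ (h zero) ℕ.+ suc (suc k)   ≡⟨ ℕ.+-suc (toℕ (h zero)) (suc k) ⟩
    suc (toℕ (h zero) ℕ.+ suc k)   ≤⟨ ℕ.+-monoˡ-≤ (suc k) (inc {zero} {suc zero} (s≤s z≤n)) ⟩
    toℕ (h (suc zero)) ℕ.+ suc k   ≤⟨ increasing-upper (h ∘ suc) (λ x<y → inc (s≤s x<y)) zero ⟩
    n ℕ.+ 0                        ∎
    where open ℕ.≤-Reasoning
  increasing-upper {suc k} {n} h inc (suc i) = begin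
    toℕ (h (suc i)) ℕ.+ suc k      ≡⟨ ℕ.+-suc (toℕ (h (suc i))) k ⟩
    suc (toℕ (h (suc i)) ℕ.+ k)    ≤⟨ s≤s (increasing-upper (h ∘ suc) (λ x<y → inc (s≤s x<y)) i) ⟩
    suc (n ℕ.+ toℕ i)              ≡⟨ ℕ.+-suc n (toℕ i) ⟨
    n ℕ.+ suc (toℕ i)              ∎
    where open ℕ.≤-Reasoning

  increasing-endo≗id : ∀ {n} (h : Fin n → Fin n) → Increasing h → ∀ i → h i ≡ i
  increasing-endo≗id {suc n} h inc i = Fin.toℕ-injective (ℕ.≤-antisym h≤i i≤h)
    where
    h≤i : toℕ (h i) ℕ.≤ toℕ i
    h≤i = ℕ.+-cancelˡ-≤ (suc n) (toℕ (h i)) (toℕ i)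
            (subst (ℕ._≤ suc n ℕ.+ toℕ i) (ℕ.+-comm (toℕ (h i)) (suc n)) (increasing-upper h inc i))
    i≤h : toℕ i ℕ.≤ toℕ (h i)
    i≤h = ℕ.≤-trans (ℕ.m≤n+m (toℕ i) (toℕ (h zero))) (increasing-lower h inc i)

  infix 4 _⇝_
  data _⇝_ {A : Set} : ∀ {k} → (Fin k → A) → (Fin k → A) → Set where
    done : ∀ {k} {f g : Fin k → A} → (∀ i → f i ≡ g i) → f ⇝ g
    step : ∀ {k} {f g h : Fin (suc k) → A} (p : Fin k) → (∀ i → g i ≡ f (swapAdj p i)) → g ⇝ h → f ⇝ h

  ⇝-respˡ : ∀ {A k} {f f′ g : Fin k → A} → (∀ i → f i ≡ f′ i) → f′ ⇝ g → f ⇝ g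
  ⇝-respˡ f≗f′ (done e)     = done λ i → trans (f≗f′ i) (e i)
  ⇝-respˡ f≗f′ (step p e r) = step p (λ i → trans (e i) (sym (f≗f′ (swapAdj p i)))) r

  ⇝-trans : ∀ {A k} {f g h : Fin k → A} → f ⇝ g → g ⇝ h → f ⇝ h
  ⇝-trans (done e)     r = ⇝-respˡ e r
  ⇝-trans (step p e r) s = step p e (⇝-trans r s)

  ⇝-∷ : ∀ {A k} (x : A) {f g : Fin k → A} → f ⇝ g → (x ∷ f) ⇝ (x ∷ g)
  ⇝-∷ x (done e)     = done λ { zero → refl ; (suc i) → e i }
  ⇝-∷ x (step p e r) = step (suc p) (λ { zero → refl ; (suc i) → e i }) (⇝-∷ x r)

  ⇝-image : ∀ {A k} {f g : Fin k → A} → f ⇝ g → ∀ i → Σ (Fin k) λ j → g i ≡ f j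
  ⇝-image (done e) i = i , sym (e i)
  ⇝-image (step p e r) i with ⇝-image r i
  ... | j , gi≡ = swapAdj p j , trans gi≡ (e j)

  det-⇝ : ∀ {A : Set} {k} (M : A → A → ℤ) {f g : Fin k → A} → f ⇝ g →
    det (λ i j → M (f i) (f j)) ≡ det (λ i j → M (g i) (g j))
  det-⇝ M (done e)         = det-cong λ i j → cong₂ M (e i) (e j)
  det-⇝ M {f} {h} (step {g = g} p e r) = begin
    det (λ i j → M (f i) (f j))                           ≡⟨ det-swapAdj p (λ i j → M (f i) (f j)) ⟨
    det (λ i j → M (f (swapAdj p i)) (f (swapAdj p j)))   ≡⟨ det-cong (λ i j → cong₂ M (e i) (e j)) ⟨
    det (λ i j → M (g i) (g j))                           ≡⟨ det-⇝ M r ⟩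
    det (λ i j → M (h i) (h j))                           ∎
    where open ≡-Reasoning

  insert : ∀ {k n} (x : Fin n) (h : Fin k → Fin n) → Increasing h → (∀ j → x ≢ h j) →
    Σ (Fin (suc k) → Fin n) λ h′ → Increasing h′ × (x ∷ h) ⇝ h′
  insert {zero} x h inc x∉h = (x ∷ h) , (λ { {zero} {zero} () }) , done λ i → refl
  insert {suc k} x h inc x∉h with ℕ.<-cmp (toℕ x) (toℕ (h zero))
  ... | tri< x<h₀ _ _ = (x ∷ h) , ∷-increasing x<h inc , done λ i → refl
    where
    x<h : ∀ j → x < h j
    x<h zero    = x<h₀
    x<h (suc j) = ℕ.<-trans x<h₀ (inc {zero} {suc j} (s≤s z≤n))
  ... | tri≈ _ x≡h₀ _ = contradiction (Fin.toℕ-injective x≡h₀) (x∉h zero)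
  ... | tri> _ _ h₀<x with insert x (h ∘ suc) (λ i<j → inc (s≤s i<j)) (x∉h ∘ suc)
  ...   | h′ , inc′ , r = (h zero ∷ h′) , ∷-increasing h₀<h′ inc′ ,
          step zero (λ { zero → refl ; (suc zero) → refl ; (suc (suc i)) → refl }) (⇝-∷ (h zero) r)
    where
    h₀<h′ : ∀ j → h zero < h′ j
    h₀<h′ j with ⇝-image r j
    ... | zero  , e = subst (λ y → h zero < y) (sym e) h₀<x
    ... | suc i , e = subst (λ y → h zero < y) (sym e) (inc {zero} {suc i} (s≤s z≤n))

  sort : ∀ {k n} (f : Fin k → Fin n) → Injective _≡_ _≡_ f → Σ (Fin k → Fin n) λ h → Increasing h × f ⇝ h
  sort {zero}  f inj = f , (λ { {()} }) , done λ i → refl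
  sort {suc k} f inj with sort (f ∘ suc) (Fin.suc-injective ∘ inj)
  ... | h′ , inc′ , r′ with insert (f zero) h′ inc′ f₀∉h′
    where
    f₀∉h′ : ∀ j → f zero ≢ h′ j
    f₀∉h′ j e with ⇝-image r′ j
    ... | i , e′ = Fin.0≢1+n (inj (trans e e′))
  ...   | h , inc , r = h , inc , ⇝-trans (⇝-respˡ (λ { zero → refl ; (suc i) → refl }) (⇝-∷ (f zero) r′)) r

  injective-endo⇝id : ∀ {n} (f : Fin n → Fin n) → Injective _≡_ _≡_ f → f ⇝ id
  injective-endo⇝id f inj with sort f inj
  ... | h , inc , f⇝h = ⇝-trans f⇝h (done (increasing-endo≗id h inc))

  rotate : ∀ {m} → Fin (suc m) → Fin (suc m)
  rotate {m} zero    = fromℕ m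
  rotate     (suc i) = inject₁ i

  rotate-injective : ∀ {m} {i j : Fin (suc m)} → rotate i ≡ rotate j → i ≡ j
  rotate-injective {i = zero}  {zero}  e = refl
  rotate-injective {i = zero}  {suc j} e = contradiction e Fin.fromℕ≢inject₁
  rotate-injective {i = suc i} {zero}  e = contradiction (sym e) Fin.fromℕ≢inject₁
  rotate-injective {i = suc i} {suc j} e = cong suc (Fin.inject₁-injective e)

  ⇝-rotate : ∀ {A m} (f : Fin (suc m) → A) → f ⇝ (f ∘ rotate)
  ⇝-rotate {m = zero}  f = done λ { zero → refl }
  ⇝-rotate {m = suc m} f =
    ⇝-trans (⇝-respˡ (λ { zero → refl ; (suc i) → refl }) (⇝-∷ (f zero) (⇝-rotate (f ∘ suc))))
            (step zero (λ { zero → refl ; (suc zero) → refl ; (suc (suc i)) → refl }) (done λ i → refl))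

  det-skew-induced-⇝ : ∀ {k n} (T : Arcs n) {f g : Fin k → Fin n} → Injective _≡_ _≡_ f → Injective _≡_ _≡_ g →
    f ⇝ g → det (skew (induced T f)) ≡ det (skew (induced T g))
  det-skew-induced-⇝ T {f} {g} inj-f inj-g f⇝g = begin
    det (skew (induced T f))          ≡⟨ det-cong (skew-induced T inj-f) ⟩
    det (λ i j → skew T (f i) (f j))  ≡⟨ det-⇝ (skew T) f⇝g ⟩
    det (λ i j → skew T (g i) (g j))  ≡⟨ det-cong (skew-induced T inj-g) ⟨
    det (skew (induced T g))          ∎
    where open ≡-Reasoning

  det-skew-relabel : ∀ {n} (T : Arcs n) (f : Fin n → Fin n) → Injective _≡_ _≡_ f →
    det (skew (induced T f)) ≡ det (skew T)
  det-skew-relabel T f inj = det-skew-induced-⇝ T inj id (injective-endo⇝id f inj)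

  det-skew-isomorphic : ∀ {k n} {T : Arcs k} {U : Arcs n} → Isomorphic T U → det (skew T) ≡ det (skew U)
  det-skew-isomorphic {T = T} {U} (σ , arcs) with ↔⇒≡ σ
  ... | refl = begin
    det (skew T)
      ≡⟨ det-cong (λ i j → cong (λ b → if does (i Fin.≟ j) then + 0 else arcSign b) (sym (arcs i j))) ⟩
    det (skew (induced U (Inverse.to σ)))
      ≡⟨ det-skew-relabel U (Inverse.to σ) (Injection.injective (↔⇒↣ σ)) ⟩
    det (skew U) ∎
    where open ≡-Reasoning

  injective-endo-isomorphic : ∀ {n} (T : Arcs n) (f : Fin n → Fin n) → Injective _≡_ _≡_ f →
    Isomorphic (induced T f) T
  injective-endo-isomorphic T f inj = mk↔ₛ′ f f⁻¹ f∘f⁻¹ (λ x → inj (f∘f⁻¹ (f x))) , λ i j → refl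
    where
    preimage = ⇝-image (injective-endo⇝id f inj)
    f⁻¹ = λ y → proj₁ (preimage y)
    f∘f⁻¹ : ∀ y → f (f⁻¹ y) ≡ y
    f∘f⁻¹ y = sym (proj₂ (preimage y))

  module _ {n : ℕ} {a b : Fin (suc n)} where

    L-transitive : toℕ a ℕ.< n → toℕ b ℕ.< n → L (suc n) a b ≡ (toℕ a <ᵇ toℕ b)
    L-transitive a<n b<n rewrite <ᵇ≡true a<n | <ᵇ≡true b<n = refl

    L-toLast : toℕ a ℕ.< n → ¬ toℕ b ℕ.< n → L (suc n) a b ≡ (toℕ a % 2 ≡ᵇ 1)
    L-toLast a<n b≮n rewrite <ᵇ≡true a<n | <ᵇ≡false b≮n = refl

    L-fromLast : ¬ toℕ a ℕ.< n → toℕ b ℕ.< n → L (suc n) a b ≡ (toℕ b % 2 ≡ᵇ 0)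
    L-fromLast a≮n b<n rewrite <ᵇ≡false a≮n | <ᵇ≡true b<n = refl

  private
    even≡not-odd : ∀ k → (k % 2 ≡ᵇ 0) ≡ not (k % 2 ≡ᵇ 1)
    even≡not-odd zero          = refl
    even≡not-odd (suc zero)    = refl
    even≡not-odd (suc (suc k)) = even≡not-odd k

    <ᵇ-flip : ∀ {m n} → m ≢ n → (n <ᵇ m) ≡ not (m <ᵇ n)
    <ᵇ-flip {m} {n} m≢n with ℕ.<-cmp m n
    ... | tri< m<n _ n≮m = trans (<ᵇ≡false n≮m) (cong not (sym (<ᵇ≡true m<n)))
    ... | tri≈ _ m≡n _   = contradiction m≡n m≢n
    ... | tri> m≮n _ n<m = trans (<ᵇ≡true n<m) (cong not (sym (<ᵇ≡false m≮n)))

    last-unique : ∀ {n} {a b : Fin (suc n)} → ¬ toℕ a ℕ.< n → ¬ toℕ b ℕ.< n → a ≡ b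
    last-unique {n} {a} {b} a≮n b≮n = Fin.toℕ-injective (trans (is-last a a≮n) (sym (is-last b b≮n)))
      where
      is-last : ∀ x → ¬ toℕ x ℕ.< n → toℕ x ≡ n
      is-last x x≮n = ℕ.≤-antisym (ℕ.s≤s⁻¹ (Fin.toℕ<n x)) (ℕ.≮⇒≥ x≮n)

  L-isTournament : ∀ {n} → IsTournament (L (suc n))
  L-isTournament {n} {a} {b} a≢b with toℕ a ℕ.<? n | toℕ b ℕ.<? n
  ... | yes a<n | yes b<n = trans (L-transitive b<n a<n)
                                 (trans (<ᵇ-flip (a≢b ∘ Fin.toℕ-injective)) (cong not (sym (L-transitive a<n b<n))))
  ... | yes a<n | no b≮n  = trans (L-fromLast b≮n a<n)
                                 (trans (even≡not-odd (toℕ a)) (cong not (sym (L-toLast a<n b≮n))))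
  ... | no a≮n  | yes b<n = trans (L-toLast b<n a≮n)
                                 (trans (sym (not-involutive _)) (cong not (trans (sym (even≡not-odd (toℕ b)))
                                                                                 (sym (L-fromLast a≮n b<n)))))
  ... | no a≮n  | no b≮n  = contradiction (last-unique a≮n b≮n) a≢b

  arcsToLast : ∀ {k n} → (Fin (suc k) → Fin (suc n)) → Fin k → ℤ
  arcsToLast {k} {n} h i = arcSign (L (suc n) (h (inject₁ i)) (h (fromℕ k)))

  -- Once the last vertex h k is moved to the front, the others h 0 < … < h (k - 1) lie in the transitive part.
  det-skew-L-increasing : ∀ {k n} (h : Fin (suc k) → Fin (suc n)) → Increasing h →
    det (skew (induced (L (suc n)) h)) ≡ det (bordered k (arcsToLast h))
  det-skew-L-increasing {k} {n} h inc = begin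
    det (skew (induced (L (suc n)) h))
      ≡⟨ det-skew-induced-⇝ (L (suc n)) inj (rotate-injective ∘ inj) (⇝-rotate h) ⟩
    det (skew (induced (L (suc n)) (h ∘ rotate)))
      ≡⟨ det-cong {N = bordered k (arcsToLast h)} (skew-bordered tour transitive-tail) ⟩
    det (bordered k (arcsToLast h)) ∎
    where
    open ≡-Reasoning
    inj = increasing⇒injective inc
    tour = induced-isTournament {T = L (suc n)} L-isTournament (rotate-injective ∘ inj)
    inject₁-increasing : Increasing (inject₁ {k})
    inject₁-increasing {i} {j} i<j = subst₂ ℕ._<_ (sym (Fin.toℕ-inject₁ i)) (sym (Fin.toℕ-inject₁ j)) i<j
    below-last : ∀ i → toℕ (h (inject₁ i)) ℕ.< n
    below-last i = ℕ.<-≤-trans (inc (subst (toℕ (inject₁ i) ℕ.<_) (sym (Fin.toℕ-fromℕ k)) (Fin.inject₁ℕ< i)))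
                               (ℕ.s≤s⁻¹ (Fin.toℕ<n (h (fromℕ k))))
    transitive-tail : ∀ i j → L (suc n) (h (inject₁ i)) (h (inject₁ j)) ≡ transitive k i j
    transitive-tail i j = trans (L-transitive (below-last i) (below-last j))
                                (increasing-<ᵇ (λ i<j → inc (inject₁-increasing i<j)) i j)

  det-skew-L-≤ : ∀ {k n} (f : Fin (suc k) → Fin (suc n)) → Injective _≡_ _≡_ f →
    det (skew (induced (L (suc n)) f)) ≤ + (k ℕ.* k)
  det-skew-L-≤ {k} {n} f inj with sort f inj
  ... | h , inc , f⇝h = begin
    det (skew (induced (L (suc n)) f))
      ≡⟨ det-skew-induced-⇝ (L (suc n)) inj (increasing⇒injective inc) f⇝h ⟩
    det (skew (induced (L (suc n)) h))
      ≡⟨ det-skew-L-increasing h inc ⟩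
    det (bordered k (arcsToLast h))
      ≤⟨ det-bordered-≤ k (arcsToLast h) (λ i → ∣arcSign∣≤1 (L (suc n) (h (inject₁ i)) (h (fromℕ k)))) ⟩
    + (k ℕ.* k) ∎
    where
    open ℤ.≤-Reasoning
    ∣arcSign∣≤1 : ∀ b → ∣ arcSign b ∣ ℕ.≤ 1
    ∣arcSign∣≤1 true  = ℕ.≤-refl
    ∣arcSign∣≤1 false = ℕ.≤-refl

  private
    arcSign-odd : ∀ k → arcSign (k % 2 ≡ᵇ 1) ≡ - sgn k
    arcSign-odd zero          = refl
    arcSign-odd (suc zero)    = refl
    arcSign-odd (suc (suc k)) = trans (arcSign-odd k) (cong -_ (sym (neg-involutive (sgn k))))

  det-skew-L : ∀ m → m % 2 ≡ 1 → det (skew (L (suc m))) ≡ + (m ℕ.* m)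
  det-skew-L m odd = begin
    det (skew (L (suc m)))                             ≡⟨ det-skew-L-increasing {m} {m} id (λ i<j → i<j) ⟩
    det (bordered m c)                                 ≡⟨ det-bordered m c ⟩
    + (m % 2) * (altSum c * altSum c)                  ≡⟨ cong₂ (λ p x → + p * (x * x)) odd altSum-c ⟩
    + 1 * ((- + m) * (- + m))                          ≡⟨ square (+ m) ⟩
    + m * + m                                          ≡⟨ pos-* m m ⟨
    + (m ℕ.* m)                                        ∎
    where
    open ≡-Reasoning
    c = arcsToLast {m} {m} id
    altSum-c : altSum c ≡ - + m
    altSum-c = begin
      altSum c                         ≡⟨ altSum-cong (λ i → trans (cong arcSign (L-toLast (Fin.inject₁ℕ< i) last≮m))
                                                                  (trans (arcSign-odd (toℕ (inject₁ i)))
                                                                         (cong (λ x → - sgn x) (Fin.toℕ-inject₁ i)))) ⟩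
      altSum {m} (λ i → - sgn (toℕ i)) ≡⟨ altSum-neg {m} (λ i → sgn (toℕ i)) ⟩
      - altSum {m} (λ i → sgn (toℕ i)) ≡⟨ cong -_ (altSum-sgn m) ⟩
      - + m                            ∎
      where
      last≮m : ¬ toℕ (fromℕ m) ℕ.< m
      last≮m = subst (λ x → ¬ x ℕ.< m) (sym (Fin.toℕ-fromℕ m)) (ℕ.<-irrefl refl)
    square : ∀ x → + 1 * ((- x) * (- x)) ≡ x * x
    square = solve-∀

open Tournament using (det-skew-L; det-skew-L-≤; det-skew-isomorphic; injective-endo-isomorphic)
import Data.Nat.Base as ℕ
import Data.Nat.Properties as ℕ
open import Data.Nat.Divisibility using (n∣m⇒m%n≡0)
import Data.Fin.Properties as Fin
import Data.Integer.Base as ℤ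
import Data.Integer.Properties as ℤ
open import Function.Bundles using (mk⇔)
open import Relation.Binary.PropositionalEquality using (refl; sym; trans; subst)
open import Data.Nat using (ℕ; _≤_; _∸_; _*_)
open import Data.Nat.Divisibility using (_∣_)
open import Data.Integer using (+_) renaming (_≤_ to _≤ℤ_)
open import Data.Fin using (Fin)
open import Data.Product using (_×_)
open import Data.Product.Base using (_,_)
open import Relation.Binary.PropositionalEquality using (_≡_)
open import Function.Definitions using (Injective)
open import Function.Bundles using (_⇔_)

private
  2∣1+m⇒m%2≡1 : ∀ m → 2 ∣ ℕ.suc m → m ℕ.% 2 ≡ 1
  2∣1+m⇒m%2≡1 m 2∣1+m = odd {m} (n∣m⇒m%n≡0 (ℕ.suc m) 2 2∣1+m)
    where
    odd : ∀ {m} → ℕ.suc m ℕ.% 2 ≡ 0 → m ℕ.% 2 ≡ 1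
    odd {ℕ.suc ℕ.zero}    _ = refl
    odd {ℕ.suc (ℕ.suc m)} e = odd {m} e

  m*m≤n*n⇒m≤n : ∀ {m n} → m * m ≤ n * n → m ≤ n
  m*m≤n*n⇒m≤n mm≤nn = ℕ.≮⇒≥ λ n<m → ℕ.<⇒≱ (ℕ.*-mono-< n<m n<m) mm≤nn

proposition4p6 : (n : ℕ) → 1 ≤ n → 2 ∣ n →
    (det (skew (L n)) ≡ + ((n ∸ 1) * (n ∸ 1)))
    × ((k : ℕ) → 1 ≤ k → (f : Fin k → Fin n) → Injective _≡_ _≡_ f →
        (det (skew (induced (L n) f)) ≤ℤ det (skew (L n)))
        × ((det (skew (induced (L n) f)) ≡ det (skew (L n)))
            ⇔ Isomorphic (induced (L n) f) (L n)))
proposition4p6 (ℕ.suc m) _ 2∣n = det-Lₙ , λ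
  { (ℕ.suc k) _ f inj → bound k f inj , mk⇔ (maximal⇒isomorphic k f inj) (det-skew-isomorphic {T = induced Lₙ f} {U = Lₙ}) }
  where
  Lₙ = L (ℕ.suc m)

  det-Lₙ : det (skew Lₙ) ≡ + (m * m)
  det-Lₙ = det-skew-L m (2∣1+m⇒m%2≡1 m 2∣n)

  bound : ∀ k (f : Fin (ℕ.suc k) → Fin (ℕ.suc m)) → Injective _≡_ _≡_ f → det (skew (induced Lₙ f)) ≤ℤ det (skew Lₙ)
  bound k f inj = ℤ.≤-trans (det-skew-L-≤ f inj) (subst (+ (k * k) ≤ℤ_) (sym det-Lₙ) (ℤ.+≤+ (ℕ.*-mono-≤ k≤m k≤m)))
    where
    k≤m = ℕ.s≤s⁻¹ (Fin.injective⇒≤ inj)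

  maximal⇒isomorphic : ∀ k (f : Fin (ℕ.suc k) → Fin (ℕ.suc m)) → Injective _≡_ _≡_ f →
    det (skew (induced Lₙ f)) ≡ det (skew Lₙ) → Isomorphic (induced Lₙ f) Lₙ
  maximal⇒isomorphic k f inj maximal with ℕ.≤-antisym (ℕ.s≤s⁻¹ (Fin.injective⇒≤ inj)) m≤k
    where
    m≤k = m*m≤n*n⇒m≤n (ℤ.drop‿+≤+ (subst (_≤ℤ + (k * k)) (trans maximal det-Lₙ) (det-skew-L-≤ f inj)))
  ... | refl = injective-endo-isomorphic Lₙ f inj
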